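{- Let $\mathcal{G}=\mathsf{G3Int}+\{(id^*),(\supset^*_l),(lift)\}$, i.e. the labelled calculus with the rules $(id),(\bot_l),(\wedge_l),(\wedge_r),(\vee_l),(\vee_r),(\supset_r),(\supset_l),(ref),(tra),(id^*),(\supset^*_l),(lift)$. Then every labelled sequent derivable in $\mathcal{G}$ is derivable in $\mathcal{G}$ without any application of $(ref)$ or $(tra)$.
   Context: Propositional formulas: $A ::= p \mid \bot \mid (A\vee A)\mid (A\wedge A)\mid (A\supset A)$. Labelled sequents $\mathcal{R},\Gamma\Rightarrow\Delta$: $\mathcal{R}$ a multiset of relational atoms $w\le v$, $\Gamma,\Delta$ multisets of labelled formulas $w:A$; components may be empty. Rules: $(id)$: $\mathcal{R},w\le v,w:p,\Gamma\Rightarrow\Delta,v:p$; $(\bot_l)$: $\mathcal{R},w:\bot,\Gamma\Rightarrow\Delta$; $(\wedge_l)$: from $\mathcal{R},w:A,w:B,\Gamma\Rightarrow\Delta$ infer $\mathcal{R},w:A\wedge B,\Gamma\Rightarrow\Delta$; $(\wedge_r)$: from $\mathcal{R},\Gamma\Rightarrow\Delta,w:A$ and $\mathcal{R},\Gamma\Rightarrow\Delta,w:B$ infer $\mathcal{R},\Gamma\Rightarrow\Delta,w:A\wedge B$; $(\vee_l)$: from $\mathcal{R},w:A,\Gamma\Rightarrow\Delta$ and $\mathcal{R},w:B,\Gamma\Rightarrow\Delta$ infer $\mathcal{R},w:A\vee B,\Gamma\Rightarrow\Delta$; $(\vee_r)$: from $\mathcal{R},\Gamma\Rightarrow\Delta,w:A,w:B$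 infer $\mathcal{R},\Gamma\Rightarrow\Delta,w:A\vee B$; $(\supset_r)$: from $\mathcal{R},w\le v,v:A,\Gamma\Rightarrow\Delta,v:B$ infer $\mathcal{R},\Gamma\Rightarrow\Delta,w:A\supset B$, provided $v$ does not occur in the conclusion; $(\supset_l)$: from $\mathcal{R},w\le v,w:A\supset B,\Gamma\Rightarrow\Delta,v:A$ and $\mathcal{R},w\le v,w:A\supset B,v:B,\Gamma\Rightarrow\Delta$ infer $\mathcal{R},w\le v,w:A\supset B,\Gamma\Rightarrow\Delta$; $(ref)$: from $\mathcal{R},w\le w,\Gamma\Rightarrow\Delta$ infer $\mathcal{R},\Gamma\Rightarrow\Delta$; $(tra)$: from $\mathcal{R},w\le v,v\le u,w\le u,\Gamma\Rightarrow\Delta$ infer $\mathcal{R},w\le v,v\le u,\Gamma\Rightarrow\Delta$; $(id^*)$: $\mathcal{R},w:p,\Gamma\Rightarrow\Delta,w:p$; $(\supset^*_l)$: from $\mathcal{R},w:A\supset B,\Gamma\Rightarrow\Delta,w:A$ and $\mathcal{R},w:A\supset B,w:B,\Gamma\Rightarrow\Delta$ infer $\mathcal{R},w:A\supset B,\Gamma\Rightarrow\Delta$; $(lift)$: from $\mathcal{R},w\le u,w:A,u:A,\Gamma\Rightarrow\Delta$ infer $\mathcal{R},w\le u,w:A,\Gamma\Rightarrow\Delta$. -}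

module Defs where

open import Data.Nat using (ℕ)
open import Data.Bool using (Bool; true; false)
open import Data.Product using (_×_; _,_)
open import Data.List using (List; []; _∷_)
open import Data.List.Relation.Unary.Any using (Any)
open import Data.List.Relation.Binary.Permutation.Propositional using (_↭_)
open import Relation.Binary.PropositionalEquality using (_≡_)
open import Relation.Nullary using (¬_)
open import Data.Sum using (_⊎_)

data Formula : Set where
  var  : ℕ → Formula
  ⊥'   : Formula
  _∨'_ : Formula → Formula → Formula
  _∧'_ : Formula → Formula → Formula
  _⊃_  : Formula → Formula → Formula

Label : Set
Label = ℕ

record RelAtom : Set where
  constructor _≤'_
  field
    src : Label
    tgt : Label

record LFormula : Set where
  constructor _∶_
  field
    lab  : Label
    form : Formula

-- Labelled sequent R , Γ ⇒ Δ ; multisets represented as lists,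
-- identified up to permutation via the exchange rule below.
infix 3 _∣_⇒_
infix 6 _∶_
infix 6 _≤'_

record Sequent : Set where
  constructor _∣_⇒_
  field
    rel : List RelAtom
    ant : List LFormula
    suc : List LFormula

OccR : Label → RelAtom → Set
OccR v (a ≤' b) = (v ≡ a) ⊎ (v ≡ b)

OccF : Label → LFormula → Set
OccF v (a ∶ _) = v ≡ a

OccursIn : Label → Sequent → Set
OccursIn v (R ∣ Γ ⇒ Δ) = Any (OccR v) R ⊎ (Any (OccF v) Γ ⊎ Any (OccF v) Δ)

-- The Bool index says whether (ref) and (tra) may be used:
--   G ⊢[ true ]  S  : derivable in G
--   G ⊢[ false ] S  : derivable in G without any application of (ref) or (tra).
data ⊢[_]_ (b : Bool) : Sequent → Set where
  exch : ∀ {R R' Γ Γ' Δ Δ'} → R ↭ R' → Γ ↭ Γ' → Δ ↭ Δ' →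
         ⊢[ b ] (R ∣ Γ ⇒ Δ) → ⊢[ b ] (R' ∣ Γ' ⇒ Δ')
  id   : ∀ {R Γ Δ w v p} →
         ⊢[ b ] ((w ≤' v) ∷ R ∣ (w ∶ var p) ∷ Γ ⇒ (v ∶ var p) ∷ Δ)
  ⊥l   : ∀ {R Γ Δ w} → ⊢[ b ] (R ∣ (w ∶ ⊥') ∷ Γ ⇒ Δ)
  ∧l   : ∀ {R Γ Δ w A B} →
         ⊢[ b ] (R ∣ (w ∶ A) ∷ (w ∶ B) ∷ Γ ⇒ Δ) →
         ⊢[ b ] (R ∣ (w ∶ (A ∧' B)) ∷ Γ ⇒ Δ)
  ∧r   : ∀ {R Γ Δ w A B} →
         ⊢[ b ] (R ∣ Γ ⇒ (w ∶ A) ∷ Δ) →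
         ⊢[ b ] (R ∣ Γ ⇒ (w ∶ B) ∷ Δ) →
         ⊢[ b ] (R ∣ Γ ⇒ (w ∶ (A ∧' B)) ∷ Δ)
  ∨l   : ∀ {R Γ Δ w A B} →
         ⊢[ b ] (R ∣ (w ∶ A) ∷ Γ ⇒ Δ) →
         ⊢[ b ] (R ∣ (w ∶ B) ∷ Γ ⇒ Δ) →
         ⊢[ b ] (R ∣ (w ∶ (A ∨' B)) ∷ Γ ⇒ Δ)
  ∨r   : ∀ {R Γ Δ w A B} →
         ⊢[ b ] (R ∣ Γ ⇒ (w ∶ A) ∷ (w ∶ B) ∷ Δ) →
         ⊢[ b ] (R ∣ Γ ⇒ (w ∶ (A ∨' B)) ∷ Δ)
  ⊃r   : ∀ {R Γ Δ w v A B} →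
         ¬ OccursIn v (R ∣ Γ ⇒ (w ∶ (A ⊃ B)) ∷ Δ) →
         ⊢[ b ] ((w ≤' v) ∷ R ∣ (v ∶ A) ∷ Γ ⇒ (v ∶ B) ∷ Δ) →
         ⊢[ b ] (R ∣ Γ ⇒ (w ∶ (A ⊃ B)) ∷ Δ)
  ⊃l   : ∀ {R Γ Δ w v A B} →
         ⊢[ b ] ((w ≤' v) ∷ R ∣ (w ∶ (A ⊃ B)) ∷ Γ ⇒ (v ∶ A) ∷ Δ) →
         ⊢[ b ] ((w ≤' v) ∷ R ∣ (w ∶ (A ⊃ B)) ∷ (v ∶ B) ∷ Γ ⇒ Δ) →
         ⊢[ b ] ((w ≤' v) ∷ R ∣ (w ∶ (A ⊃ B)) ∷ Γ ⇒ Δ)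
  ref  : ∀ {R Γ Δ w} → b ≡ true →
         ⊢[ b ] ((w ≤' w) ∷ R ∣ Γ ⇒ Δ) →
         ⊢[ b ] (R ∣ Γ ⇒ Δ)
  tra  : ∀ {R Γ Δ w v u} → b ≡ true →
         ⊢[ b ] ((w ≤' v) ∷ (v ≤' u) ∷ (w ≤' u) ∷ R ∣ Γ ⇒ Δ) →
         ⊢[ b ] ((w ≤' v) ∷ (v ≤' u) ∷ R ∣ Γ ⇒ Δ)
  id*  : ∀ {R Γ Δ w p} →
         ⊢[ b ] (R ∣ (w ∶ var p) ∷ Γ ⇒ (w ∶ var p) ∷ Δ)
  ⊃*l  : ∀ {R Γ Δ w A B} →
         ⊢[ b ] (R ∣ (w ∶ (A ⊃ B)) ∷ Γ ⇒ (w ∶ A) ∷ Δ) →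
         ⊢[ b ] (R ∣ (w ∶ (A ⊃ B)) ∷ (w ∶ B) ∷ Γ ⇒ Δ) →
         ⊢[ b ] (R ∣ (w ∶ (A ⊃ B)) ∷ Γ ⇒ Δ)
  lift : ∀ {R Γ Δ w u A} →
         ⊢[ b ] ((w ≤' u) ∷ R ∣ (w ∶ A) ∷ (u ∶ A) ∷ Γ ⇒ Δ) →
         ⊢[ b ] ((w ≤' u) ∷ R ∣ (w ∶ A) ∷ Γ ⇒ Δ)

-- Eliminate the topmost (ref) or (tra) first. A (ref)/(tra)-free derivation
-- of  R, w ≤ w, Γ ⇒ Δ  or of  R, w ≤ v, v ≤ u, w ≤ u, Γ ⇒ Δ  is simulated rule
-- by rule over the smaller relational context, in which every atom of the old
-- one is present, reflexive, or the composite of two present atoms. An (id) or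
-- (⊃l) step along an atom that is no longer present becomes (lift)s of its
-- principal formula along the (at most two) present atoms, closed by (id*) or
-- (⊃*l). As there is no contraction, the simulating antecedent is only required
-- to generate the old one under ∧/∨-introduction, so that a left rule may
-- consume a formula which is still needed elsewhere; and it never introduces
-- new labels, which keeps the eigenvariable conditions of (⊃r) satisfied.
module Submission where

open import Defs
open import Data.Bool using (Bool; true; false)
open import Data.Product using (Σ-syntax; ∃; _×_; _,_)
open import Data.Sum using (inj₁; inj₂)
import Data.Sum as Sum
open import Data.List using (List; _∷_; _++_)
open import Data.List.Relation.Unary.Any using (Any; here; there)
import Data.List.Relation.Unary.Any as Any
open import Data.List.Membership.Propositional using (_∈_)
open import Data.List.Membership.Propositional.Properties using (∈-∃++)
open import Data.List.Relation.Binary.Subset.Propositional using (_⊆_)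
open import Data.List.Relation.Binary.Permutation.Propositional
  using (_↭_; refl; prep; swap; trans; ↭-sym)
open import Data.List.Relation.Binary.Permutation.Propositional.Properties
  using (Any-resp-↭; ∈-resp-↭; shift)
open import Function using (_∘_)
open import Relation.Binary.PropositionalEquality using (refl)

∈⇒↭∷ : ∀ {A : Set} {x : A} {xs} → x ∈ xs → ∃ λ ys → xs ↭ x ∷ ys
∈⇒↭∷ x∈xs with ys , zs , refl ← ∈-∃++ x∈xs = ys ++ zs , shift _ ys zs

module _ {b : Bool} {R : List RelAtom} {Γ Δ : List LFormula} where

  id*-∈ : ∀ {w p} → (w ∶ var p) ∈ Γ → (w ∶ var p) ∈ Δ → ⊢[ b ] (R ∣ Γ ⇒ Δ)
  id*-∈ l r with _ , Γ↭ ← ∈⇒↭∷ l | _ , Δ↭ ← ∈⇒↭∷ r =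
    exch refl (↭-sym Γ↭) (↭-sym Δ↭) id*

  ⊥l-∈ : ∀ {w} → (w ∶ ⊥') ∈ Γ → ⊢[ b ] (R ∣ Γ ⇒ Δ)
  ⊥l-∈ m with _ , Γ↭ ← ∈⇒↭∷ m = exch refl (↭-sym Γ↭) refl ⊥l

  ⊃*l-∈ : ∀ {w A B} → (w ∶ (A ⊃ B)) ∈ Γ →
          ⊢[ b ] (R ∣ Γ ⇒ (w ∶ A) ∷ Δ) → ⊢[ b ] (R ∣ (w ∶ B) ∷ Γ ⇒ Δ) →
          ⊢[ b ] (R ∣ Γ ⇒ Δ)
  ⊃*l-∈ m d₁ d₂ with _ , Γ↭ ← ∈⇒↭∷ m =
    exch refl (↭-sym Γ↭) refl
      (⊃*l (exch refl Γ↭ refl d₁)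
           (exch refl (trans (prep _ Γ↭) (swap _ _ refl)) refl d₂))

  lift-∈ : ∀ {w u A} → (w ≤' u) ∈ R → (w ∶ A) ∈ Γ →
           ⊢[ b ] (R ∣ (u ∶ A) ∷ Γ ⇒ Δ) → ⊢[ b ] (R ∣ Γ ⇒ Δ)
  lift-∈ a m d with _ , R↭ ← ∈⇒↭∷ a | _ , Γ↭ ← ∈⇒↭∷ m =
    exch (↭-sym R↭) (↭-sym Γ↭) refl
      (lift (exch R↭ (trans (prep _ Γ↭) (swap _ _ refl)) refl d))

infix  4 _∈ᶜ_ _⊆ᶜ_
infixr 5 _∷ᶜ_

data _∈ᶜ_ : LFormula → List LFormula → Set where
  member : ∀ {x Γ} → x ∈ Γ → x ∈ᶜ Γ
  ∧ᶜ     : ∀ {w A B Γ} → (w ∶ A) ∈ᶜ Γ → (w ∶ B) ∈ᶜ Γ → (w ∶ (A ∧' B)) ∈ᶜ Γ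
  ∨ᶜˡ    : ∀ {w A B Γ} → (w ∶ A) ∈ᶜ Γ → (w ∶ (A ∨' B)) ∈ᶜ Γ
  ∨ᶜʳ    : ∀ {w A B Γ} → (w ∶ B) ∈ᶜ Γ → (w ∶ (A ∨' B)) ∈ᶜ Γ

_⊆ᶜ_ : List LFormula → List LFormula → Set
Γ ⊆ᶜ Γ' = ∀ {x} → x ∈ Γ → x ∈ᶜ Γ'

∈ᶜ-bind : ∀ {Γ Γ' x} → Γ ⊆ᶜ Γ' → x ∈ᶜ Γ → x ∈ᶜ Γ'
∈ᶜ-bind f (member m) = f m
∈ᶜ-bind f (∧ᶜ c₁ c₂) = ∧ᶜ (∈ᶜ-bind f c₁) (∈ᶜ-bind f c₂)
∈ᶜ-bind f (∨ᶜˡ c)    = ∨ᶜˡ (∈ᶜ-bind f c)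
∈ᶜ-bind f (∨ᶜʳ c)    = ∨ᶜʳ (∈ᶜ-bind f c)

⊆ᶜ-trans : ∀ {Γ₁ Γ₂ Γ₃} → Γ₁ ⊆ᶜ Γ₂ → Γ₂ ⊆ᶜ Γ₃ → Γ₁ ⊆ᶜ Γ₃
⊆ᶜ-trans f g = ∈ᶜ-bind g ∘ f

⊆ᶜ-weaken : ∀ {Γ Γ' y} → Γ ⊆ᶜ Γ' → Γ ⊆ᶜ (y ∷ Γ')
⊆ᶜ-weaken f = ∈ᶜ-bind (member ∘ there) ∘ f

_∷ᶜ_ : ∀ {Γ Γ' x} → x ∈ᶜ Γ' → Γ ⊆ᶜ Γ' → (x ∷ Γ) ⊆ᶜ Γ'
(c ∷ᶜ f) (here refl) = c
(c ∷ᶜ f) (there m)   = f m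

⊆ᶜ-skip : ∀ {Γ Γ' x y} → y ∈ᶜ Γ' → (x ∷ Γ) ⊆ᶜ Γ' → (x ∷ y ∷ Γ) ⊆ᶜ Γ'
⊆ᶜ-skip c cl = cl (here refl) ∷ᶜ c ∷ᶜ cl ∘ there

∈ᶜ⇒∈-var : ∀ {w p Γ} → (w ∶ var p) ∈ᶜ Γ → (w ∶ var p) ∈ Γ
∈ᶜ⇒∈-var (member m) = m

∈ᶜ⇒∈-⊥ : ∀ {w Γ} → (w ∶ ⊥') ∈ᶜ Γ → (w ∶ ⊥') ∈ Γ
∈ᶜ⇒∈-⊥ (member m) = m

∈ᶜ⇒∈-⊃ : ∀ {w A B Γ} → (w ∶ (A ⊃ B)) ∈ᶜ Γ → (w ∶ (A ⊃ B)) ∈ Γ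
∈ᶜ⇒∈-⊃ (member m) = m

infix 4 _⊆ˡ_

_⊆ˡ_ : Sequent → Sequent → Set
S ⊆ˡ T = ∀ {v} → OccursIn v S → OccursIn v T

⊆ˡ-map : ∀ {R R₁ Γ Γ₁ Δ Δ₁} →
         (∀ {v} → Any (OccR v) R → Any (OccR v) R₁) →
         (∀ {v} → Any (OccF v) Γ → Any (OccF v) Γ₁) →
         (∀ {v} → Any (OccF v) Δ → Any (OccF v) Δ₁) →
         (R ∣ Γ ⇒ Δ) ⊆ˡ (R₁ ∣ Γ₁ ⇒ Δ₁)
⊆ˡ-map f g h = Sum.map f (Sum.map g h)

⊆ˡ-↭ : ∀ {R R₁ Γ Γ₁ Δ Δ₁} → R ↭ R₁ → Γ ↭ Γ₁ → Δ ↭ Δ₁ → (R ∣ Γ ⇒ Δ) ⊆ˡ (R₁ ∣ Γ₁ ⇒ Δ₁)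
⊆ˡ-↭ pR pΓ pΔ = ⊆ˡ-map (Any-resp-↭ pR) (Any-resp-↭ pΓ) (Any-resp-↭ pΔ)

⊆ˡ-ant : ∀ {R Γ Γ₁ Δ} → (∀ {v} → Any (OccF v) Γ → Any (OccF v) Γ₁) → (R ∣ Γ ⇒ Δ) ⊆ˡ (R ∣ Γ₁ ⇒ Δ)
⊆ˡ-ant g = ⊆ˡ-map (λ o → o) g (λ o → o)

⊆ˡ-suc : ∀ {R Γ Δ Δ₁} → (∀ {v} → Any (OccF v) Δ → Any (OccF v) Δ₁) → (R ∣ Γ ⇒ Δ) ⊆ˡ (R ∣ Γ ⇒ Δ₁)
⊆ˡ-suc h = ⊆ˡ-map (λ o → o) (λ o → o) h

module _ {R R₁ : List RelAtom} {Γ Γ₁ Δ Δ₁ : List LFormula} {x : LFormula}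
         (inc : (R ∣ Γ ⇒ Δ) ⊆ˡ (R₁ ∣ Γ₁ ⇒ Δ₁)) where

  ⊆ˡ-∷ˡ : (R ∣ x ∷ Γ ⇒ Δ) ⊆ˡ (R₁ ∣ x ∷ Γ₁ ⇒ Δ₁)
  ⊆ˡ-∷ˡ (inj₂ (inj₁ (here e)))  = inj₂ (inj₁ (here e))
  ⊆ˡ-∷ˡ (inj₂ (inj₁ (there q))) = ⊆ˡ-ant there (inc (inj₂ (inj₁ q)))
  ⊆ˡ-∷ˡ (inj₁ q)                = ⊆ˡ-ant there (inc (inj₁ q))
  ⊆ˡ-∷ˡ (inj₂ (inj₂ q))         = ⊆ˡ-ant there (inc (inj₂ (inj₂ q)))

  ⊆ˡ-∷ʳ : (R ∣ Γ ⇒ x ∷ Δ) ⊆ˡ (R₁ ∣ Γ₁ ⇒ x ∷ Δ₁)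
  ⊆ˡ-∷ʳ (inj₂ (inj₂ (here e)))  = inj₂ (inj₂ (here e))
  ⊆ˡ-∷ʳ (inj₂ (inj₂ (there q))) = ⊆ˡ-suc there (inc (inj₂ (inj₂ q)))
  ⊆ˡ-∷ʳ (inj₁ q)                = ⊆ˡ-suc there (inc (inj₁ q))
  ⊆ˡ-∷ʳ (inj₂ (inj₁ q))         = ⊆ˡ-suc there (inc (inj₂ (inj₁ q)))

relabel : ∀ {v w A B Γ} → Any (OccF v) ((w ∶ A) ∷ Γ) → Any (OccF v) ((w ∶ B) ∷ Γ)
relabel (here e)  = here e
relabel (there q) = there q

merge-second : ∀ {v w A B C Γ} →
               Any (OccF v) ((w ∶ A) ∷ (w ∶ B) ∷ Γ) → Any (OccF v) ((w ∶ C) ∷ Γ)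
merge-second (here e)          = here e
merge-second (there (here e))  = here e
merge-second (there (there q)) = there q

Any-skip : ∀ {A : Set} {P : A → Set} {x y xs} → Any P (x ∷ xs) → Any P (x ∷ y ∷ xs)
Any-skip (here p)  = here p
Any-skip (there q) = there (there q)

⊆ˡ-⊃r-premise : ∀ {R Γ Δ w v A B} →
                (R ∣ Γ ⇒ (w ∶ (A ⊃ B)) ∷ Δ) ⊆ˡ ((w ≤' v) ∷ R ∣ (v ∶ A) ∷ Γ ⇒ (v ∶ B) ∷ Δ)
⊆ˡ-⊃r-premise (inj₁ q)                = inj₁ (there q)
⊆ˡ-⊃r-premise (inj₂ (inj₁ q))         = inj₂ (inj₁ (there q))
⊆ˡ-⊃r-premise (inj₂ (inj₂ (here e)))  = inj₁ (here (inj₁ e))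
⊆ˡ-⊃r-premise (inj₂ (inj₂ (there q))) = inj₂ (inj₂ (there q))

⊆ˡ-⊃r : ∀ {R R₁ Γ Γ₁ Δ w v A B} →
        (R ∣ Γ ⇒ (w ∶ (A ⊃ B)) ∷ Δ) ⊆ˡ (R₁ ∣ Γ₁ ⇒ (w ∶ (A ⊃ B)) ∷ Δ) →
        ((w ≤' v) ∷ R ∣ (v ∶ A) ∷ Γ ⇒ (v ∶ B) ∷ Δ) ⊆ˡ ((w ≤' v) ∷ R₁ ∣ (v ∶ A) ∷ Γ₁ ⇒ (v ∶ B) ∷ Δ)
⊆ˡ-⊃r inc (inj₁ (here e))          = inj₁ (here e)
⊆ˡ-⊃r inc (inj₁ (there q))         = ⊆ˡ-⊃r-premise (inc (inj₁ q))
⊆ˡ-⊃r inc (inj₂ (inj₁ (here e)))   = inj₂ (inj₁ (here e))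
⊆ˡ-⊃r inc (inj₂ (inj₁ (there q)))  = ⊆ˡ-⊃r-premise (inc (inj₂ (inj₁ q)))
⊆ˡ-⊃r inc (inj₂ (inj₂ (here e)))   = inj₂ (inj₂ (here e))
⊆ˡ-⊃r inc (inj₂ (inj₂ (there q)))  = inj₂ (inj₂ (there q))

focus-covers : ∀ {Γ Γ⁺ x ys} → Γ ↭ x ∷ ys → x ∈ᶜ Γ⁺ → ys ⊆ Γ⁺ → Γ ⊆ᶜ Γ⁺
focus-covers Γ↭ c inc = (c ∷ᶜ member ∘ inc) ∘ ∈-resp-↭ Γ↭

⊆ᶜ-focus : ∀ {Γ Γ' x y ys} → Γ' ↭ x ∷ ys → x ∈ᶜ (y ∷ ys) →
           (x ∷ Γ) ⊆ᶜ Γ' → (y ∷ Γ) ⊆ᶜ (y ∷ ys)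
⊆ᶜ-focus Γ'↭ c cl = member (here refl) ∷ᶜ ⊆ᶜ-trans (cl ∘ there) (focus-covers Γ'↭ c there)

⊆ˡ-focus : ∀ {R R' Γ Γ' Δ w C D ys} → Γ' ↭ (w ∶ D) ∷ ys →
           (R' ∣ Γ' ⇒ Δ) ⊆ˡ (R ∣ (w ∶ D) ∷ Γ ⇒ Δ) →
           (R' ∣ (w ∶ C) ∷ ys ⇒ Δ) ⊆ˡ (R ∣ (w ∶ C) ∷ Γ ⇒ Δ)
⊆ˡ-focus Γ'↭ inv = ⊆ˡ-ant relabel ∘ inv ∘ ⊆ˡ-ant (Any-resp-↭ (↭-sym Γ'↭) ∘ relabel)

data Justified (R : List RelAtom) : RelAtom → Set where
  present   : ∀ {a} → a ∈ R → Justified R a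
  reflexive : ∀ {w} → Justified R (w ≤' w)
  composite : ∀ {w z u} → (w ≤' z) ∈ R → (z ≤' u) ∈ R → Justified R (w ≤' u)

infix 4 _⊆ʲ_

_⊆ʲ_ : List RelAtom → List RelAtom → Set
R ⊆ʲ R' = ∀ {a} → a ∈ R → Justified R' a

⊆ʲ-∷ : ∀ {R R' c} → R ⊆ʲ R' → (c ∷ R) ⊆ʲ (c ∷ R')
⊆ʲ-∷ just (here refl) = present (here refl)
⊆ʲ-∷ just (there m) with just m
... | present m'      = present (there m')
... | reflexive       = reflexive
... | composite m₁ m₂ = composite (there m₁) (there m₂)

record Refines (R : List RelAtom) (Γ⁺ Γ : List LFormula) : Set where
  field
    covers : Γ ⊆ᶜ Γ⁺
    labels : ∀ {Δ} → (R ∣ Γ⁺ ⇒ Δ) ⊆ˡ (R ∣ Γ ⇒ Δ)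
    reduce : ∀ {Δ} → ⊢[ false ] (R ∣ Γ⁺ ⇒ Δ) → ⊢[ false ] (R ∣ Γ ⇒ Δ)
open Refines

Refines-refl : ∀ {R Γ} → Refines R Γ Γ
Refines-refl = record { covers = member ; labels = λ o → o ; reduce = λ d → d }

Refines-trans : ∀ {R Γ₁ Γ₂ Γ₃} → Refines R Γ₃ Γ₂ → Refines R Γ₂ Γ₁ → Refines R Γ₃ Γ₁
Refines-trans E F = record
  { covers = ⊆ᶜ-trans (covers F) (covers E)
  ; labels = labels F ∘ labels E
  ; reduce = reduce F ∘ reduce E
  }

lift-refines : ∀ {R Γ w u A} → (w ≤' u) ∈ R → (w ∶ A) ∈ Γ → Refines R ((u ∶ A) ∷ Γ) Γ
lift-refines {R} {Γ} {u = u} {A} a m =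
  record { covers = member ∘ there ; labels = target-label ; reduce = lift-∈ a m }
  where
  target-label : ∀ {Δ} → (R ∣ (u ∶ A) ∷ Γ ⇒ Δ) ⊆ˡ (R ∣ Γ ⇒ Δ)
  target-label (inj₂ (inj₁ (here refl))) = inj₁ (Any.map (λ { refl → inj₂ refl }) a)
  target-label (inj₂ (inj₁ (there q)))   = inj₂ (inj₁ q)
  target-label (inj₁ q)                  = inj₁ q
  target-label (inj₂ (inj₂ q))           = inj₂ (inj₂ q)

lift-∈ᶜ : ∀ {R Γ w u A} → (w ≤' u) ∈ R → (w ∶ A) ∈ᶜ Γ →
          Σ[ Γ⁺ ∈ List LFormula ] Refines R Γ⁺ Γ × (u ∶ A) ∈ᶜ Γ⁺
lift-∈ᶜ a (member m) = _ , lift-refines a m , member (here refl)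
lift-∈ᶜ a (∧ᶜ c₁ c₂) =
  let _  , E₁ , c₁⁺ = lift-∈ᶜ a c₁
      Γ₂ , E₂ , c₂⁺ = lift-∈ᶜ a (∈ᶜ-bind (covers E₁) c₂)
  in  Γ₂ , Refines-trans E₂ E₁ , ∧ᶜ (∈ᶜ-bind (covers E₂) c₁⁺) c₂⁺
lift-∈ᶜ a (∨ᶜˡ c) = let Γ⁺ , E , c⁺ = lift-∈ᶜ a c in Γ⁺ , E , ∨ᶜˡ c⁺
lift-∈ᶜ a (∨ᶜʳ c) = let Γ⁺ , E , c⁺ = lift-∈ᶜ a c in Γ⁺ , E , ∨ᶜʳ c⁺

lift-justified : ∀ {R Γ w u A} → Justified R (w ≤' u) → (w ∶ A) ∈ᶜ Γ →
                 Σ[ Γ⁺ ∈ List LFormula ] Refines R Γ⁺ Γ × (u ∶ A) ∈ᶜ Γ⁺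
lift-justified (present a)     c = lift-∈ᶜ a c
lift-justified reflexive       c = _ , Refines-refl , c
lift-justified (composite a b) c =
  let _  , E₁ , c₁ = lift-∈ᶜ a c
      Γ₂ , E₂ , c₂ = lift-∈ᶜ b c₁
  in  Γ₂ , Refines-trans E₂ E₁ , c₂

∧l-refines : ∀ {R Γ w A B} → (w ∶ (A ∧' B)) ∈ Γ →
             ∃ λ ys → Refines R ((w ∶ A) ∷ (w ∶ B) ∷ ys) Γ
∧l-refines m with ys , Γ↭ ← ∈⇒↭∷ m = ys , record
  { covers = focus-covers Γ↭ (∧ᶜ (member (here refl)) (member (there (here refl)))) (there ∘ there)
  ; labels = ⊆ˡ-ant (Any-resp-↭ (↭-sym Γ↭) ∘ merge-second)
  ; reduce = exch refl (↭-sym Γ↭) refl ∘ ∧l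
  }

simulate : ∀ {R Γ Δ R' Γ'} → ⊢[ false ] (R ∣ Γ ⇒ Δ) →
           R ⊆ʲ R' → Γ ⊆ᶜ Γ' → (R' ∣ Γ' ⇒ Δ) ⊆ˡ (R ∣ Γ ⇒ Δ) →
           ⊢[ false ] (R' ∣ Γ' ⇒ Δ)
simulate (exch pR pΓ pΔ d) just cl inv =
  exch refl refl pΔ
    (simulate d (just ∘ ∈-resp-↭ pR) (cl ∘ ∈-resp-↭ pΓ)
      (⊆ˡ-↭ (↭-sym pR) (↭-sym pΓ) (↭-sym pΔ) ∘ inv ∘ ⊆ˡ-suc (Any-resp-↭ pΔ)))
simulate id just cl inv
  with _ , E , v∶p ← lift-justified (just (here refl)) (cl (here refl)) =
  reduce E (id*-∈ (∈ᶜ⇒∈-var v∶p) (here refl))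
simulate id* just cl inv = id*-∈ (∈ᶜ⇒∈-var (cl (here refl))) (here refl)
simulate ⊥l just cl inv = ⊥l-∈ (∈ᶜ⇒∈-⊥ (cl (here refl)))
simulate (∧l d) just cl inv with cl (here refl)
... | ∧ᶜ cA cB = simulate d just (cA ∷ᶜ cB ∷ᶜ cl ∘ there) (⊆ˡ-ant (Any-skip ∘ relabel) ∘ inv)
... | member m with _ , E ← ∧l-refines m =
  reduce E
    (simulate d just
      (member (here refl) ∷ᶜ member (there (here refl)) ∷ᶜ ⊆ᶜ-trans (cl ∘ there) (covers E))
      (⊆ˡ-ant (Any-skip ∘ relabel) ∘ inv ∘ labels E))
simulate (∨l d₁ d₂) just cl inv with cl (here refl)
... | ∨ᶜˡ cA = simulate d₁ just (cA ∷ᶜ cl ∘ there) (⊆ˡ-ant relabel ∘ inv)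
... | ∨ᶜʳ cB = simulate d₂ just (cB ∷ᶜ cl ∘ there) (⊆ˡ-ant relabel ∘ inv)
... | member m with _ , Γ'↭ ← ∈⇒↭∷ m =
  exch refl (↭-sym Γ'↭) refl
    (∨l (simulate d₁ just (⊆ᶜ-focus Γ'↭ (∨ᶜˡ (member (here refl))) cl) (⊆ˡ-focus Γ'↭ inv))
        (simulate d₂ just (⊆ᶜ-focus Γ'↭ (∨ᶜʳ (member (here refl))) cl) (⊆ˡ-focus Γ'↭ inv)))
simulate (∧r d₁ d₂) just cl inv =
  ∧r (simulate d₁ just cl (⊆ˡ-suc relabel ∘ inv ∘ ⊆ˡ-suc relabel))
     (simulate d₂ just cl (⊆ˡ-suc relabel ∘ inv ∘ ⊆ˡ-suc relabel))
simulate (∨r d) just cl inv =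
  ∨r (simulate d just cl (⊆ˡ-suc (Any-skip ∘ relabel) ∘ inv ∘ ⊆ˡ-suc merge-second))
simulate (⊃r fresh d) just cl inv =
  ⊃r (fresh ∘ inv) (simulate d (⊆ʲ-∷ just) (member (here refl) ∷ᶜ ⊆ᶜ-weaken cl) (⊆ˡ-⊃r inv))
simulate (⊃l d₁ d₂) just cl inv
  with _ , E , v∶A⊃B ← lift-justified (just (here refl)) (cl (here refl)) =
  reduce E
    (⊃*l-∈ (∈ᶜ⇒∈-⊃ v∶A⊃B)
      (simulate d₁ just (⊆ᶜ-trans cl (covers E)) (⊆ˡ-∷ʳ (inv ∘ labels E)))
      (simulate d₂ just
        (⊆ᶜ-skip (member (here refl)) (⊆ᶜ-weaken (⊆ᶜ-trans cl (covers E))))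
        (⊆ˡ-ant (Any-resp-↭ (swap _ _ refl)) ∘ ⊆ˡ-∷ˡ (inv ∘ labels E))))
simulate (⊃*l d₁ d₂) just cl inv =
  ⊃*l-∈ (∈ᶜ⇒∈-⊃ (cl (here refl)))
    (simulate d₁ just cl (⊆ˡ-∷ʳ inv))
    (simulate d₂ just
      (⊆ᶜ-skip (member (here refl)) (⊆ᶜ-weaken cl))
      (⊆ˡ-ant (Any-resp-↭ (swap _ _ refl)) ∘ ⊆ˡ-∷ˡ inv))
simulate (lift d) just cl inv
  with _ , E , u∶A ← lift-justified (just (here refl)) (cl (here refl)) =
  reduce E (simulate d just (⊆ᶜ-skip u∶A (⊆ᶜ-trans cl (covers E))) (⊆ˡ-ant Any-skip ∘ inv ∘ labels E))
simulate (ref () _) _ _ _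
simulate (tra () _) _ _ _

ref-elim : ∀ {R Γ Δ w} → ⊢[ false ] ((w ≤' w) ∷ R ∣ Γ ⇒ Δ) → ⊢[ false ] (R ∣ Γ ⇒ Δ)
ref-elim d = simulate d justify member (⊆ˡ-map there (λ o → o) (λ o → o))
  where
  justify : ∀ {R w} → ((w ≤' w) ∷ R) ⊆ʲ R
  justify (here refl) = reflexive
  justify (there m)   = present m

tra-elim : ∀ {R Γ Δ w v u} → ⊢[ false ] ((w ≤' v) ∷ (v ≤' u) ∷ (w ≤' u) ∷ R ∣ Γ ⇒ Δ) →
           ⊢[ false ] ((w ≤' v) ∷ (v ≤' u) ∷ R ∣ Γ ⇒ Δ)
tra-elim d = simulate d justify member (⊆ˡ-map (λ { (here e) → here e ; (there q) → there (Any-skip q) }) (λ o → o) (λ o → o))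
  where
  justify : ∀ {R w v u} → ((w ≤' v) ∷ (v ≤' u) ∷ (w ≤' u) ∷ R) ⊆ʲ ((w ≤' v) ∷ (v ≤' u) ∷ R)
  justify (here refl)                 = present (here refl)
  justify (there (here refl))         = present (there (here refl))
  justify (there (there (here refl))) = composite (here refl) (there (here refl))
  justify (there (there (there m)))   = present (there (there m))

ref-tra-elim : ∀ {S} → ⊢[ true ] S → ⊢[ false ] S
ref-tra-elim (exch pR pΓ pΔ d) = exch pR pΓ pΔ (ref-tra-elim d)
ref-tra-elim id                = id
ref-tra-elim ⊥l                = ⊥l
ref-tra-elim (∧l d)            = ∧l (ref-tra-elim d)
ref-tra-elim (∧r d₁ d₂)        = ∧r (ref-tra-elim d₁) (ref-tra-elim d₂)
ref-tra-elim (∨l d₁ d₂)        = ∨l (ref-tra-elim d₁) (ref-tra-elim d₂)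
ref-tra-elim (∨r d)            = ∨r (ref-tra-elim d)
ref-tra-elim (⊃r fresh d)      = ⊃r fresh (ref-tra-elim d)
ref-tra-elim (⊃l d₁ d₂)        = ⊃l (ref-tra-elim d₁) (ref-tra-elim d₂)
ref-tra-elim (ref _ d)         = ref-elim (ref-tra-elim d)
ref-tra-elim (tra _ d)         = tra-elim (ref-tra-elim d)
ref-tra-elim id*               = id*
ref-tra-elim (⊃*l d₁ d₂)       = ⊃*l (ref-tra-elim d₁) (ref-tra-elim d₂)
ref-tra-elim (lift d)          = lift (ref-tra-elim d)

lemma6 : ∀ (S : Sequent) → ⊢[ true ] S → ⊢[ false ] S
lemma6 S = ref-tra-elim
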